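{- Let $p_1\ge p_2\ge \dots\ge p_n>0$ be integers, an instance of the triangle scheduling problem. Let $S=p_{\lceil n/2\rceil+1}+\dots+p_n$, and let $m=p_{(n+1)/2}$ if $n$ is odd and $m=0$ if $n$ is even. Then the optimal makespan $\mathrm{OPT}$ of the instance satisfies $\mathrm{OPT}\ge m+2S$.
   Context: Triangle scheduling problem (TS): given integers $p_1\ge \dots\ge p_n>0$, a feasible schedule is a choice of starting times $s_1,\dots,s_n\ge 0$ such that for all $i\ne j$, $|s_i-s_j|\ge \min\{p_i,p_j\}$. Its makespan is $\max_j (s_j+p_j)$. $\mathrm{OPT}$ denotes the minimum makespan over all feasible schedules.
   Formalization: The starting times of a feasible schedule take only rational values, so the bound OPT ≥ m+2S is asserted for schedules with rational starting times. -}

module Defs where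

open import Data.Nat as ℕ using (ℕ; zero; suc; ⌊_/2⌋; ⌈_/2⌉)
open import Data.Fin using (Fin; toℕ)
import Data.Rational as Q
import Data.Integer as ℤ
open import Data.Rational using (ℚ; 0ℚ; _+_; _-_; _≤_; _⊔_; ∣_∣)
open import Data.Bool using (Bool; if_then_else_; _∧_; not)
open import Data.Product using (_×_)
open import Relation.Binary.PropositionalEquality using (_≢_)

-- Instance of the triangle scheduling problem: processing times p : Fin n → ℕ
-- (0-based index i corresponds to p_{i+1} in the paper).
IsInstance : (n : ℕ) → (Fin n → ℕ) → Set
IsInstance n p = (∀ (i j : Fin n) → toℕ i ℕ.≤ toℕ j → p j ℕ.≤ p i)
               × (∀ (i : Fin n) → 0 ℕ.< p i)

natℚ : ℕ → ℚ
natℚ k = ℤ.+ k Q./ 1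

pℚ : ∀ {n} → (Fin n → ℕ) → Fin n → ℚ
pℚ p i = natℚ (p i)

Feasible : (n : ℕ) → (Fin n → ℕ) → (Fin n → ℚ) → Set
Feasible n p s = (∀ (j : Fin n) → 0ℚ ≤ s j)
               × (∀ (i j : Fin n) → i ≢ j → natℚ (ℕ._⊓_ (p i) (p j)) ≤ ∣ s i - s j ∣)

maxFin : ∀ n → (Fin n → ℚ) → ℚ
maxFin zero f = 0ℚ
maxFin (suc n) f = f Fin.zero ⊔ maxFin n (λ i → f (Fin.suc i))
  where import Data.Fin as Fin

makespan : ∀ n → (Fin n → ℕ) → (Fin n → ℚ) → ℚ
makespan n p s = maxFin n (λ j → s j + pℚ p j)

sumFin : ∀ k → (Fin k → ℕ) → ℕ
sumFin zero f = 0
sumFin (suc k) f = f Fin.zero ℕ.+ sumFin k (λ i → f (Fin.suc i))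
  where import Data.Fin as Fin

-- S = p_{⌈n/2⌉+1} + … + p_n  (0-based indices i with ⌈n/2⌉ ≤ i)
S : ∀ n → (Fin n → ℕ) → ℕ
S n p = sumFin n (λ i → if ⌈ n /2⌉ ℕ.≤ᵇ toℕ i then p i else 0)

-- m = p_{(n+1)/2} if n odd (0-based index ⌊n/2⌋ = (n-1)/2), and m = 0 if n even.
-- Written as a sum over i with the single possibly-nonzero term.
middle : ∀ n → (Fin n → ℕ) → ℕ
middle n p = sumFin n (λ i → if isOdd n ∧ (toℕ i ℕ.≡ᵇ ⌊ n /2⌋) then p i else 0)
  where
  isOdd : ℕ → Bool
  isOdd k = not (k ℕ.% 2 ℕ.≡ᵇ 0)

module Submission where

-- Since every p_i ≥ 1, feasibility makes the start times distinct. Listing the jobs by start time,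
-- consecutive jobs i, j satisfy s_j ≥ s_i + min(p_i, p_j), so the makespan is at least the sum of
-- min(p_i, p_j) over consecutive pairs plus the length of the last job. Writing
-- min(p_i, p_j) = #{t : p_i > t and p_j > t}, fix a threshold t and call a job long if p > t. In any
-- ordering, the number of consecutive long-long pairs plus [last job long] is at least
-- #long − #short. Summing (#long_t − #short_t)⁺ = (2 #long_t − n)⁺ over all t gives exactly m + 2S,
-- because the k-th longest job (1-based) contributes weight 2 if k > ⌈n/2⌉, weight 1 if 2k = n + 1,
-- and nothing otherwise. The count for a fixed t is established backwards along the schedule, one
-- job at a time.

open import Defs

module LowerBound where
  open import Data.Bool using (Bool; true; false; not; _∧_; if_then_else_; T)
  open import Data.Bool.Properties using (∧-zeroʳ)
  open import Data.Empty using (⊥-elim)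
  open import Data.Fin as F using (Fin; toℕ)
  open import Data.Fin.Properties using (any?)
  open import Data.Integer as ℤ using (+≤+)
  import Data.Integer.Properties as ZP
  open import Data.Nat as ℕ
    using (ℕ; zero; suc; _+_; _*_; _∸_; _≤_; _<_; _⊓_; _<ᵇ_; _≤ᵇ_; _≡ᵇ_; z≤n; s≤s; ⌊_/2⌋; ⌈_/2⌉)
  open import Data.Nat.Coprimality as Coprime using (1-coprimeTo)
  open import Data.Nat.Induction using (<-wellFounded)
  open import Data.Nat.Properties
  open import Data.Nat.Tactic.RingSolver using (solve-∀)
  open import Data.Product using (_×_; _,_; proj₁; proj₂; ∃; ∃-syntax)
  open import Data.Rational as Q using (ℚ; 0ℚ; mkℚ; *≤*)
  import Data.Rational.Properties as QP
  open import Data.Sum using (inj₁; inj₂)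
  open import Data.Unit using (⊤; tt)
  open import Data.Vec.Functional using (Vector)
  open import Function using (_∘_; _on_; mk⇔)
  open import Induction.WellFounded using (Acc; acc)
  open import Relation.Binary using (TotalOrder; DecTotalOrder)
  import Relation.Binary.Construct.On as On
  open import Relation.Binary.PropositionalEquality
  open import Relation.Nullary using (yes; no; does; ¬_)
  open import Relation.Nullary.Decidable using (does-⇔; dec-true; dec-false)
  open import Relation.Unary using (Pred; Decidable)

  open import Algebra.Properties.Group QP.+-0-group using (//-rightDividesˡ)
  open import Algebra.Properties.Semiring.Sum +-*-semiring
    using (sum; sum-syntax; sum-cong-≗; ∑-distrib-+; ∑-comm; *-distribˡ-sum; *-distribʳ-sum;
           sum-replicate-zero)

  sumFin≡sum : ∀ k (f : Vector ℕ k) → sumFin k f ≡ sum f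
  sumFin≡sum zero f = refl
  sumFin≡sum (suc k) f = cong (f F.zero +_) (sumFin≡sum k (f ∘ F.suc))

  sum-mono-≤ : ∀ {k} {f g : Vector ℕ k} → (∀ i → f i ≤ g i) → sum f ≤ sum g
  sum-mono-≤ {zero} f≤g = z≤n
  sum-mono-≤ {suc k} f≤g = +-mono-≤ (f≤g F.zero) (sum-mono-≤ (f≤g ∘ F.suc))

  𝟙 : Bool → ℕ
  𝟙 true = 1
  𝟙 false = 0

  if-then-0≡𝟙* : ∀ b x → (if b then x else 0) ≡ 𝟙 b * x
  if-then-0≡𝟙* true x = sym (*-identityˡ x)
  if-then-0≡𝟙* false x = refl

  sum-𝟙+𝟙-not : ∀ {k} (g : Fin k → Bool) → ∑[ i < k ] 𝟙 (g i) + ∑[ i < k ] 𝟙 (not (g i)) ≡ k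
  sum-𝟙+𝟙-not {zero} g = refl
  sum-𝟙+𝟙-not {suc k} g with g F.zero
  ... | true = cong suc (sum-𝟙+𝟙-not (g ∘ F.suc))
  ... | false = trans (+-suc _ _) (cong suc (sum-𝟙+𝟙-not (g ∘ F.suc)))

  δ : ∀ {k} → Fin k → Fin k → ℕ
  δ e i = 𝟙 (does (e F.≟ i))

  sum-δ : ∀ {k} (e : Fin k) (g : Vector ℕ k) → ∑[ i < k ] (δ e i * g i) ≡ g e
  sum-δ {suc k} F.zero g = begin
    1 * g F.zero + sum {k} (λ _ → 0)  ≡⟨ cong₂ _+_ (*-identityˡ (g F.zero)) (sum-replicate-zero k) ⟩
    g F.zero + 0                       ≡⟨ +-identityʳ (g F.zero) ⟩
    g F.zero                           ∎
    where open ≡-Reasoning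
  sum-δ {suc k} (F.suc e) g = sum-δ e (g ∘ F.suc)

  sum-δ+ : ∀ {k} (e : Fin k) {A B : Vector ℕ k} → (∀ i → A i ≡ δ e i + B i) → (g : Vector ℕ k) →
           ∑[ i < k ] (A i * g i) ≡ g e + ∑[ i < k ] (B i * g i)
  sum-δ+ {k} e {A} {B} A≡δ+B g = begin
    ∑[ i < k ] (A i * g i)
      ≡⟨ sum-cong-≗ (λ i → trans (cong (_* g i) (A≡δ+B i)) (*-distribʳ-+ (g i) (δ e i) (B i))) ⟩
    ∑[ i < k ] (δ e i * g i + B i * g i)
      ≡⟨ ∑-distrib-+ (λ i → δ e i * g i) (λ i → B i * g i) ⟩
    ∑[ i < k ] (δ e i * g i) + ∑[ i < k ] (B i * g i)
      ≡⟨ cong (_+ ∑[ i < k ] (B i * g i)) (sum-δ e g) ⟩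
    g e + ∑[ i < k ] (B i * g i)
      ∎
    where open ≡-Reasoning

  sum-𝟙[<ᵇ]≡⊓ : ∀ N a → ∑[ t < N ] 𝟙 (toℕ t <ᵇ a) ≡ N ⊓ a
  sum-𝟙[<ᵇ]≡⊓ zero a = refl
  sum-𝟙[<ᵇ]≡⊓ (suc N) zero = sum-replicate-zero N
  sum-𝟙[<ᵇ]≡⊓ (suc N) (suc a) = cong suc (sum-𝟙[<ᵇ]≡⊓ N a)

  𝟙[<ᵇ]*𝟙[<ᵇ]≡𝟙[<ᵇ⊓] : ∀ t a b → 𝟙 (t <ᵇ a) * 𝟙 (t <ᵇ b) ≡ 𝟙 (t <ᵇ a ⊓ b)
  𝟙[<ᵇ]*𝟙[<ᵇ]≡𝟙[<ᵇ⊓] t zero b = refl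
  𝟙[<ᵇ]*𝟙[<ᵇ]≡𝟙[<ᵇ⊓] t (suc a) zero = *-zeroʳ (𝟙 (t <ᵇ suc a))
  𝟙[<ᵇ]*𝟙[<ᵇ]≡𝟙[<ᵇ⊓] zero (suc a) (suc b) = refl
  𝟙[<ᵇ]*𝟙[<ᵇ]≡𝟙[<ᵇ⊓] (suc t) (suc a) (suc b) = 𝟙[<ᵇ]*𝟙[<ᵇ]≡𝟙[<ᵇ⊓] t a b

  sum-𝟙-downClosed : ∀ {k} (g : Fin k → Bool) → (∀ i j → toℕ i ≤ toℕ j → T (g j) → T (g i)) →
    (f : ℕ → ℕ) → ∑[ i < k ] (𝟙 (g i) * f (toℕ i)) ≡ ∑[ j < ∑[ i < k ] 𝟙 (g i) ] f (toℕ j)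
  sum-𝟙-downClosed {zero} g closed f = refl
  sum-𝟙-downClosed {suc k} g closed f with g F.zero in g0
  ... | true = cong₂ _+_ (*-identityˡ (f 0))
    (sum-𝟙-downClosed (g ∘ F.suc) (λ i j i≤j → closed (F.suc i) (F.suc j) (s≤s i≤j)) (f ∘ suc))
  ... | false = begin
    0 + ∑[ i < k ] (𝟙 (g (F.suc i)) * f (suc (toℕ i)))
      ≡⟨ sum-cong-≗ (λ i → cong (λ b → 𝟙 b * f (suc (toℕ i))) (rest-false i)) ⟩
    sum {k} (λ _ → 0)
      ≡⟨ sum-replicate-zero k ⟩
    0
      ≡⟨ cong (λ c → ∑[ j < c ] f (toℕ j)) (trans (sum-cong-≗ (cong 𝟙 ∘ rest-false)) (sum-replicate-zero k)) ⟨
    ∑[ j < ∑[ i < k ] 𝟙 (g (F.suc i)) ] f (toℕ j)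
      ∎
    where
    open ≡-Reasoning
    rest-false : ∀ i → g (F.suc i) ≡ false
    rest-false i with g (F.suc i) in gi
    ... | false = refl
    ... | true = ⊥-elim (subst T g0 (closed F.zero (F.suc i) z≤n (subst T (sym gi) tt)))

  odd : ℕ → Bool
  odd n = not (n ℕ.% 2 ≡ᵇ 0)

  weight : ℕ → ℕ → ℕ
  weight n j = 𝟙 (odd n ∧ (j ≡ᵇ ⌊ n /2⌋)) + 2 * 𝟙 (⌈ n /2⌉ ≤ᵇ j)

  middle+2S≡∑weight : ∀ n p → middle n p + 2 * S n p ≡ ∑[ i < n ] (p i * weight n (toℕ i))
  middle+2S≡∑weight n p = begin
    middle n p + 2 * S n p
      ≡⟨ cong₂ (λ a b → a + 2 * b) (sum-if≡sum-𝟙* isMiddle) (sum-if≡sum-𝟙* isUpper) ⟩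
    ∑[ i < n ] (𝟙 (isMiddle i) * p i) + 2 * ∑[ i < n ] (𝟙 (isUpper i) * p i)
      ≡⟨ cong (∑[ i < n ] (𝟙 (isMiddle i) * p i) +_) (*-distribˡ-sum 2 (λ i → 𝟙 (isUpper i) * p i)) ⟩
    ∑[ i < n ] (𝟙 (isMiddle i) * p i) + ∑[ i < n ] (2 * (𝟙 (isUpper i) * p i))
      ≡⟨ ∑-distrib-+ (λ i → 𝟙 (isMiddle i) * p i) (λ i → 2 * (𝟙 (isUpper i) * p i)) ⟨
    ∑[ i < n ] (𝟙 (isMiddle i) * p i + 2 * (𝟙 (isUpper i) * p i))
      ≡⟨ sum-cong-≗ (λ i → collect (𝟙 (isMiddle i)) (𝟙 (isUpper i)) (p i)) ⟩
    ∑[ i < n ] (p i * weight n (toℕ i))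
      ∎
    where
    open ≡-Reasoning
    isMiddle isUpper : Fin n → Bool
    isMiddle i = odd n ∧ (toℕ i ≡ᵇ ⌊ n /2⌋)
    isUpper i = ⌈ n /2⌉ ≤ᵇ toℕ i
    sum-if≡sum-𝟙* : ∀ b → sumFin n (λ i → if b i then p i else 0) ≡ ∑[ i < n ] (𝟙 (b i) * p i)
    sum-if≡sum-𝟙* b = trans (sumFin≡sum n _) (sum-cong-≗ (λ i → if-then-0≡𝟙* (b i) (p i)))
    collect : ∀ x y z → x * z + 2 * (y * z) ≡ z * (x + 2 * y)
    collect = solve-∀

  ≤ᵇ-suc : ∀ m j → (suc m ≤ᵇ suc j) ≡ (m ≤ᵇ j)
  ≤ᵇ-suc zero j = refl
  ≤ᵇ-suc (suc m) j = refl

  weight-shift : ∀ n j → weight (suc (suc n)) (suc j) ≡ weight n j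
  weight-shift n j = cong (λ b → 𝟙 (odd n ∧ (j ≡ᵇ ⌊ n /2⌋)) + 2 * 𝟙 b) (≤ᵇ-suc ⌈ n /2⌉ j)

  sum-weight : ∀ n b → ∑[ j < b ] weight n (toℕ j) ≡ (b + b) ∸ n
  sum-weight n zero = sym (0∸n≡0 n)
  sum-weight zero (suc b) = trans (cong (2 +_) (sum-weight zero b)) (cong suc (sym (+-suc b b)))
  sum-weight (suc zero) (suc b) = trans (cong suc (sum-weight zero b)) (sym (+-suc b b))
  sum-weight (suc (suc n)) (suc b) = begin
    𝟙 (odd n ∧ false) + 0 + ∑[ j < b ] weight (suc (suc n)) (suc (toℕ j))
      ≡⟨ cong₂ _+_ (cong (λ x → 𝟙 x + 0) (∧-zeroʳ (odd n))) (sum-cong-≗ {b} (weight-shift n ∘ toℕ)) ⟩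
    ∑[ j < b ] weight n (toℕ j)   ≡⟨ sum-weight n b ⟩
    (b + b) ∸ n                   ≡⟨ cong (_∸ suc n) (+-suc b b) ⟨
    (b + suc b) ∸ suc n           ∎
    where open ≡-Reasoning

  numLonger : ∀ {n} → (Fin n → ℕ) → ℕ → ℕ
  numLonger {n} p t = ∑[ i < n ] 𝟙 (t <ᵇ p i)

  middle+2S≡∑numLonger : ∀ n p → (∀ i j → toℕ i ≤ toℕ j → p j ≤ p i) → ∀ N → (∀ i → p i ≤ N) →
    middle n p + 2 * S n p ≡ ∑[ t < N ] ((numLonger p (toℕ t) + numLonger p (toℕ t)) ∸ n)
  middle+2S≡∑numLonger n p sorted N p≤N = begin
    middle n p + 2 * S n p
      ≡⟨ middle+2S≡∑weight n p ⟩
    ∑[ i < n ] (p i * w i)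
      ≡⟨ sum-cong-≗ {n} (λ i → cong (_* w i) (p≡∑ i)) ⟩
    ∑[ i < n ] (∑[ t < N ] 𝟙 (toℕ t <ᵇ p i) * w i)
      ≡⟨ sum-cong-≗ {n} (λ i → *-distribʳ-sum {N} (w i) (λ t → 𝟙 (toℕ t <ᵇ p i))) ⟩
    ∑[ i < n ] ∑[ t < N ] (𝟙 (toℕ t <ᵇ p i) * w i)
      ≡⟨ ∑-comm {n} {N} (λ i t → 𝟙 (toℕ t <ᵇ p i) * w i) ⟩
    ∑[ t < N ] ∑[ i < n ] (𝟙 (toℕ t <ᵇ p i) * w i)
      ≡⟨ sum-cong-≗ {N} (λ t → sum-𝟙-downClosed (λ i → toℕ t <ᵇ p i) (longer-downClosed (toℕ t)) (weight n)) ⟩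
    ∑[ t < N ] ∑[ j < numLonger p (toℕ t) ] weight n (toℕ j)
      ≡⟨ sum-cong-≗ {N} (λ t → sum-weight n (numLonger p (toℕ t))) ⟩
    ∑[ t < N ] ((numLonger p (toℕ t) + numLonger p (toℕ t)) ∸ n)
      ∎
    where
    open ≡-Reasoning
    w : Fin n → ℕ
    w i = weight n (toℕ i)
    p≡∑ : ∀ i → p i ≡ ∑[ t < N ] 𝟙 (toℕ t <ᵇ p i)
    p≡∑ i = sym (trans (sum-𝟙[<ᵇ]≡⊓ N (p i)) (m≥n⇒m⊓n≡n (p≤N i)))
    longer-downClosed : ∀ t i j → toℕ i ≤ toℕ j → T (t <ᵇ p j) → T (t <ᵇ p i)
    longer-downClosed t i j i≤j t<pj = <⇒<ᵇ (≤-trans (<ᵇ⇒< t (p j) t<pj) (sorted i j i≤j))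

  natℚ≡mkℚ : ∀ k → natℚ k ≡ mkℚ (ℤ.+ k) 0 (Coprime.sym (1-coprimeTo k))
  natℚ≡mkℚ k = QP.normalize-coprime (Coprime.sym (1-coprimeTo k))

  natℚ-mono-≤ : ∀ {a b} → a ≤ b → natℚ a Q.≤ natℚ b
  natℚ-mono-≤ {a} {b} a≤b rewrite natℚ≡mkℚ a | natℚ≡mkℚ b =
    *≤* (subst₂ ℤ._≤_ (sym (ZP.*-identityʳ (ℤ.+ a))) (sym (ZP.*-identityʳ (ℤ.+ b))) (+≤+ a≤b))

  natℚ-+ : ∀ a b → natℚ (a + b) ≡ natℚ a Q.+ natℚ b
  natℚ-+ a b rewrite natℚ≡mkℚ a | natℚ≡mkℚ b =
    cong (Q._/ 1) (sym (cong₂ ℤ._+_ (ZP.*-identityʳ (ℤ.+ a)) (ZP.*-identityʳ (ℤ.+ b))))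

  ≤-maxFin : ∀ k (f : Fin k → ℚ) i → f i Q.≤ maxFin k f
  ≤-maxFin (suc k) f F.zero = QP.p≤p⊔q (f F.zero) _
  ≤-maxFin (suc k) f (F.suc i) = QP.≤-trans (≤-maxFin k (f ∘ F.suc) i) (QP.p≤q⊔p (f F.zero) _)

  module _ {c ℓ₁ ℓ₂} (ord : TotalOrder c ℓ₁ ℓ₂) where
    open TotalOrder ord using (Carrier)
      renaming (_≤_ to _≼_; refl to ≼-refl; trans to ≼-trans; total to ≼-total)

    argmin-on : ∀ {k ℓ} (f : Fin k → Carrier) {P : Pred (Fin k) ℓ} → Decidable P → ∃ P →
                ∃[ j ] P j × (∀ i → P i → f j ≼ f i)
    argmin-on {suc k} f {P} P? (i , Pi) with any? (P? ∘ F.suc)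
    ... | no ¬P∘suc =
      F.zero , P-zero i Pi , λ { F.zero _ → ≼-refl ; (F.suc i) Psi → ⊥-elim (¬P∘suc (i , Psi)) }
      where
      P-zero : ∀ i → P i → P F.zero
      P-zero F.zero P0 = P0
      P-zero (F.suc i) Psi = ⊥-elim (¬P∘suc (i , Psi))
    ... | yes ∃P∘suc with argmin-on (f ∘ F.suc) (P? ∘ F.suc) ∃P∘suc | P? F.zero
    ...   | j , Psj , min | no ¬P0 = F.suc j , Psj , λ { F.zero P0 → ⊥-elim (¬P0 P0) ; (F.suc i) → min i }
    ...   | j , Psj , min | yes P0 with ≼-total (f F.zero) (f (F.suc j))
    ...     | inj₁ f0≤ = F.zero , P0 , λ { F.zero _ → ≼-refl ; (F.suc i) Psi → ≼-trans f0≤ (min i Psi) }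
    ...     | inj₂ ≤f0 = F.suc j , Psj , λ { F.zero _ → ≤f0 ; (F.suc i) → min i }

  excess-last : ∀ x → (𝟙 (not x) + (𝟙 x + 0)) ∸ (𝟙 (not x) + 0) ≤ 𝟙 x
  excess-last true = ≤-refl
  excess-last false = z≤n

  -- x, y: whether a job and its successor are long; L, S: the long and short jobs from the successor on.
  excess-step : ∀ x y L S → (𝟙 (not x) + (𝟙 x + L)) ∸ (𝟙 (not x) + S) ≤ 𝟙 x * 𝟙 y + ((𝟙 (not y) + L) ∸ S)
  excess-step true true L S =
    m≤n+o⇒m∸n≤o (suc L) S (≤-trans (s≤s (m≤n+m∸n L S)) (≤-reflexive (sym (+-suc S (L ∸ S)))))
  excess-step true false L S = ≤-refl
  excess-step false y L S = ∸-monoˡ-≤ S (m≤n+m L (𝟙 (not y)))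

  ℚ-≤-totalOrder : TotalOrder _ _ _
  ℚ-≤-totalOrder = DecTotalOrder.totalOrder QP.≤-decTotalOrder

  module Schedule (n : ℕ) (p : Fin n → ℕ) (p>0 : ∀ i → 0 < p i)
                  (s : Fin n → ℚ) (feasible : Feasible n p s) where

    start-injective : ∀ {i j} → s i ≡ s j → i ≡ j
    start-injective {i} {j} si≡sj with i F.≟ j
    ... | yes i≡j = i≡j
    ... | no i≢j = ⊥-elim (1≰0 (QP.≤-trans (natℚ-mono-≤ (⊓-glb (p>0 i) (p>0 j))) gap≤0))
      where
      gap≤0 : natℚ (p i ⊓ p j) Q.≤ 0ℚ
      gap≤0 = subst (λ x → natℚ (p i ⊓ p j) Q.≤ Q.∣ x ∣)
                    (trans (cong (λ x → s i Q.- x) (sym si≡sj)) (QP.+-inverseʳ (s i)))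
                    (proj₂ feasible i j i≢j)
      1≰0 : ¬ natℚ 1 Q.≤ 0ℚ
      1≰0 (*≤* (+≤+ ()))

    start-≤∧≢⇒< : ∀ {i j} → i ≢ j → s i Q.≤ s j → s i Q.< s j
    start-≤∧≢⇒< {i} {j} i≢j si≤sj with s i Q.<? s j
    ... | yes si<sj = si<sj
    ... | no si≮sj = ⊥-elim (i≢j (start-injective (QP.≤-antisym si≤sj (QP.≮⇒≥ si≮sj))))

    separation : ∀ {i j} → s i Q.< s j → natℚ (p i ⊓ p j) Q.+ s i Q.≤ s j
    separation {i} {j} si<sj = begin
      natℚ (p i ⊓ p j) Q.+ s i     ≡⟨ cong (λ m → natℚ m Q.+ s i) (⊓-comm (p i) (p j)) ⟩
      natℚ (p j ⊓ p i) Q.+ s i     ≤⟨ QP.+-monoˡ-≤ (s i) (proj₂ feasible j i j≢i) ⟩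
      Q.∣ s j Q.- s i ∣ Q.+ s i    ≡⟨ cong (Q._+ s i) (QP.0≤p⇒∣p∣≡p 0≤sj-si) ⟩
      s j Q.- s i Q.+ s i          ≡⟨ //-rightDividesˡ (s i) (s j) ⟩
      s j                          ∎
      where
      open QP.≤-Reasoning
      j≢i : j ≢ i
      j≢i refl = QP.<-irrefl refl si<sj
      0≤sj-si : 0ℚ Q.≤ s j Q.- s i
      0≤sj-si = subst (Q._≤ s j Q.- s i) (QP.+-inverseʳ (s i)) (QP.+-monoˡ-≤ (Q.- s i) (QP.<⇒≤ si<sj))

    after : Fin n → Fin n → ℕ
    after e i = 𝟙 (does (s e Q.≤? s i))

    numAfter : Fin n → ℕ
    numAfter e = ∑[ i < n ] after e i

    after-self : ∀ e → after e e ≡ 1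
    after-self e = cong 𝟙 (dec-true (s e Q.≤? s e) QP.≤-refl)

    after-last : ∀ {e} → (∀ i → ¬ s e Q.< s i) → ∀ i → after e i ≡ δ e i + 0
    after-last {e} none-later i with e F.≟ i
    ... | yes refl = after-self e
    ... | no e≢i = cong 𝟙 (dec-false (s e Q.≤? s i) (none-later i ∘ start-≤∧≢⇒< e≢i))

    after-next : ∀ {e e'} → s e Q.< s e' → (∀ i → s e Q.< s i → s e' Q.≤ s i) →
                 ∀ i → after e i ≡ δ e i + after e' i
    after-next {e} {e'} e<e' e'-first i with e F.≟ i
    ... | yes refl = trans (after-self e) (sym (cong suc (cong 𝟙 (dec-false (s e' Q.≤? s e) e'≰e))))
      where
      e'≰e : ¬ s e' Q.≤ s e
      e'≰e e'≤e = QP.<-irrefl refl (QP.<-≤-trans e<e' e'≤e)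
    ... | no e≢i = cong 𝟙 (does-⇔ (mk⇔ (e'-first i ∘ start-≤∧≢⇒< e≢i) (QP.<⇒≤ ∘ QP.<-≤-trans e<e'))
                                  (s e Q.≤? s i) (s e' Q.≤? s i))

    numAfter-next : ∀ {e e'} → (∀ i → after e i ≡ δ e i + after e' i) → numAfter e' < numAfter e
    numAfter-next {e} {e'} split = ≤-reflexive (sym (begin
      ∑[ i < n ] after e i             ≡⟨ sum-cong-≗ (λ i → sym (*-identityʳ (after e i))) ⟩
      ∑[ i < n ] (after e i * 1)       ≡⟨ sum-δ+ e split (λ _ → 1) ⟩
      1 + ∑[ i < n ] (after e' i * 1)  ≡⟨ cong suc (sum-cong-≗ (λ i → *-identityʳ (after e' i))) ⟩
      suc (∑[ i < n ] after e' i)      ∎))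
      where open ≡-Reasoning

    longIn shortIn : (Fin n → ℕ) → ℕ → ℕ
    longIn A t = ∑[ i < n ] (A i * 𝟙 (t <ᵇ p i))
    shortIn A t = ∑[ i < n ] (A i * 𝟙 (not (t <ᵇ p i)))

    -- (#long − #short)⁺ over the jobs starting no earlier than e, where a short e is not counted: it is
    -- at most the number of consecutive pairs of long jobs from e on, the last job pairing with itself.
    excess : Fin n → ℕ → ℕ
    excess e t = (𝟙 (not (t <ᵇ p e)) + longIn (after e) t) ∸ shortIn (after e) t

    potential : ℕ → Fin n → ℕ
    potential N e = ∑[ t < N ] excess e (toℕ t)

    excess-split : ∀ {e B} → (∀ i → after e i ≡ δ e i + B i) → ∀ t →
      excess e t ≡ (𝟙 (not (t <ᵇ p e)) + (𝟙 (t <ᵇ p e) + longIn B t))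
                   ∸ (𝟙 (not (t <ᵇ p e)) + shortIn B t)
    excess-split {e} split t =
      cong₂ (λ L S → (𝟙 (not (t <ᵇ p e)) + L) ∸ S) (sum-δ+ e split _) (sum-δ+ e split _)

    potential-last : ∀ N {e} → (∀ i → after e i ≡ δ e i + 0) → potential N e ≤ p e
    potential-last N {e} split = begin
      ∑[ t < N ] excess e (toℕ t)      ≤⟨ sum-mono-≤ {N} (λ t → excess≤ (toℕ t)) ⟩
      ∑[ t < N ] 𝟙 (toℕ t <ᵇ p e)      ≡⟨ sum-𝟙[<ᵇ]≡⊓ N (p e) ⟩
      N ⊓ p e                          ≤⟨ m⊓n≤n N (p e) ⟩
      p e                              ∎
      where
      open ≤-Reasoning
      excess≤ : ∀ t → excess e t ≤ 𝟙 (t <ᵇ p e)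
      excess≤ t = ≤-trans (≤-reflexive (trans (excess-split split t)
                    (cong₂ (λ L S → (𝟙 (not (t <ᵇ p e)) + (𝟙 (t <ᵇ p e) + L)) ∸ (𝟙 (not (t <ᵇ p e)) + S))
                           (sum-replicate-zero n) (sum-replicate-zero n))))
                  (excess-last (t <ᵇ p e))

    potential-step : ∀ N {e e'} → (∀ i → after e i ≡ δ e i + after e' i) →
                     potential N e ≤ p e ⊓ p e' + potential N e'
    potential-step N {e} {e'} split = begin
      ∑[ t < N ] excess e (toℕ t)
        ≤⟨ sum-mono-≤ {N} (λ t → excess≤ (toℕ t)) ⟩
      ∑[ t < N ] (both (toℕ t) + excess e' (toℕ t))
        ≡⟨ ∑-distrib-+ {N} (both ∘ toℕ) (λ t → excess e' (toℕ t)) ⟩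
      ∑[ t < N ] both (toℕ t) + potential N e'
        ≡⟨ cong (_+ potential N e') ∑both ⟩
      N ⊓ (p e ⊓ p e') + potential N e'
        ≤⟨ +-monoˡ-≤ (potential N e') (m⊓n≤n N (p e ⊓ p e')) ⟩
      p e ⊓ p e' + potential N e'
        ∎
      where
      open ≤-Reasoning
      both : ℕ → ℕ
      both t = 𝟙 (t <ᵇ p e) * 𝟙 (t <ᵇ p e')
      excess≤ : ∀ t → excess e t ≤ both t + excess e' t
      excess≤ t = subst (_≤ both t + excess e' t) (sym (excess-split split t))
                    (excess-step (t <ᵇ p e) (t <ᵇ p e') (longIn (after e') t) (shortIn (after e') t))
      ∑both : ∑[ t < N ] both (toℕ t) ≡ N ⊓ (p e ⊓ p e')
      ∑both = trans (sum-cong-≗ {N} (λ t → 𝟙[<ᵇ]*𝟙[<ᵇ]≡𝟙[<ᵇ⊓] (toℕ t) (p e) (p e')))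
                  (sum-𝟙[<ᵇ]≡⊓ N (p e ⊓ p e'))

    excess-first : ∀ {e} → (∀ i → s e Q.≤ s i) → ∀ t → (numLonger p t + numLonger p t) ∸ n ≤ excess e t
    excess-first {e} e-first t = begin
      (L + L) ∸ n                           ≡⟨ cong ((L + L) ∸_) (sym (sum-𝟙+𝟙-not (λ i → t <ᵇ p i))) ⟩
      (L + L) ∸ (L + Sh)                    ≡⟨ [m+n]∸[m+o]≡n∸o L L Sh ⟩
      L ∸ Sh                                ≤⟨ ∸-monoˡ-≤ Sh (m≤n+m L (𝟙 (not (t <ᵇ p e)))) ⟩
      (𝟙 (not (t <ᵇ p e)) + L) ∸ Sh         ≡⟨ cong₂ (λ L' Sh' → (𝟙 (not (t <ᵇ p e)) + L') ∸ Sh')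
                                                     (in-all (λ i → 𝟙 (t <ᵇ p i)))
                                                     (in-all (λ i → 𝟙 (not (t <ᵇ p i)))) ⟨
      excess e t                            ∎
      where
      open ≤-Reasoning
      L Sh : ℕ
      L = numLonger p t
      Sh = ∑[ i < n ] 𝟙 (not (t <ᵇ p i))
      in-all : ∀ g → ∑[ i < n ] (after e i * g i) ≡ ∑[ i < n ] g i
      in-all g = sum-cong-≗ {n} (λ i → trans (cong (λ b → 𝟙 b * g i) (dec-true (s e Q.≤? s i) (e-first i)))
                                             (*-identityˡ (g i)))

    potential+start≤makespan : ∀ N e → Acc (_<_ on numAfter) e →
                               natℚ (potential N e) Q.+ s e Q.≤ makespan n p s
    potential+start≤makespan N e (acc rec) with any? (λ i → s e Q.<? s i)
    ... | no ¬later = begin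
      natℚ (potential N e) Q.+ s e   ≤⟨ QP.+-monoˡ-≤ (s e) (natℚ-mono-≤ (potential-last N split)) ⟩
      natℚ (p e) Q.+ s e             ≡⟨ QP.+-comm (natℚ (p e)) (s e) ⟩
      s e Q.+ pℚ p e                 ≤⟨ ≤-maxFin n (λ j → s j Q.+ pℚ p j) e ⟩
      makespan n p s                 ∎
      where
      open QP.≤-Reasoning
      split : ∀ i → after e i ≡ δ e i + 0
      split = after-last (λ i → ¬later ∘ (i ,_))
    ... | yes later with argmin-on ℚ-≤-totalOrder s (λ i → s e Q.<? s i) later
    ...   | e' , e<e' , e'-first = begin
      natℚ (potential N e) Q.+ s e
        ≤⟨ QP.+-monoˡ-≤ (s e) (natℚ-mono-≤ (potential-step N split)) ⟩
      natℚ (p e ⊓ p e' + potential N e') Q.+ s e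
        ≡⟨ cong (Q._+ s e) (natℚ-+ (p e ⊓ p e') (potential N e')) ⟩
      natℚ (p e ⊓ p e') Q.+ natℚ (potential N e') Q.+ s e
        ≡⟨ cong (Q._+ s e) (QP.+-comm (natℚ (p e ⊓ p e')) (natℚ (potential N e'))) ⟩
      natℚ (potential N e') Q.+ natℚ (p e ⊓ p e') Q.+ s e
        ≡⟨ QP.+-assoc (natℚ (potential N e')) (natℚ (p e ⊓ p e')) (s e) ⟩
      natℚ (potential N e') Q.+ (natℚ (p e ⊓ p e') Q.+ s e)
        ≤⟨ QP.+-monoʳ-≤ (natℚ (potential N e')) (separation e<e') ⟩
      natℚ (potential N e') Q.+ s e'
        ≤⟨ potential+start≤makespan N e' (rec (numAfter-next split)) ⟩
      makespan n p s
        ∎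
      where
      open QP.≤-Reasoning
      split : ∀ i → after e i ≡ δ e i + after e' i
      split = after-next e<e' e'-first

    earliest : Fin n → ∃[ e ] (∀ i → s e Q.≤ s i)
    earliest i with argmin-on ℚ-≤-totalOrder s {P = λ _ → ⊤} (λ _ → yes tt) (i , tt)
    ... | e , _ , e-min = e , λ j → e-min j tt

    potential≤makespan : ∀ N e → natℚ (potential N e) Q.≤ makespan n p s
    potential≤makespan N e = begin
      natℚ (potential N e)           ≡⟨ QP.+-identityʳ (natℚ (potential N e)) ⟨
      natℚ (potential N e) Q.+ 0ℚ    ≤⟨ QP.+-monoʳ-≤ (natℚ (potential N e)) (proj₁ feasible e) ⟩
      natℚ (potential N e) Q.+ s e   ≤⟨ potential+start≤makespan N e (On.wellFounded numAfter <-wellFounded e) ⟩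
      makespan n p s                 ∎
      where open QP.≤-Reasoning

    middle+2S≤potential : (∀ i j → toℕ i ≤ toℕ j → p j ≤ p i) → ∀ N → (∀ i → p i ≤ N) →
                          ∀ {e} → (∀ i → s e Q.≤ s i) → middle n p + 2 * S n p ≤ potential N e
    middle+2S≤potential sorted N p≤N e-first =
      ≤-trans (≤-reflexive (middle+2S≡∑numLonger n p sorted N p≤N))
              (sum-mono-≤ {N} (λ t → excess-first e-first (toℕ t)))

open LowerBound
open import Data.Fin using (Fin; zero)
open import Data.Nat using (ℕ; suc; _+_; _*_; z≤n)
open import Data.Product using (_,_; proj₁; proj₂)
open import Data.Rational using (ℚ; _≤_)
open import Data.Rational.Properties using (≤-refl; ≤-trans)

mainTheorem1 : (n : ℕ) (p : Fin n → ℕ) → IsInstance n p →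
    (s : Fin n → ℚ) → Feasible n p s →
    natℚ (middle n p + 2 * S n p) ≤ makespan n p s
mainTheorem1 0 p _ s _ = ≤-refl
mainTheorem1 n@(suc _) p (sorted , p>0) s feasible =
  ≤-trans (natℚ-mono-≤ (middle+2S≤potential sorted (p zero) (λ i → sorted zero i z≤n) e₀-first))
          (potential≤makespan (p zero) e₀)
  where
  open Schedule n p p>0 s feasible
  e₀ : Fin n
  e₀ = proj₁ (earliest zero)
  e₀-first : ∀ i → s e₀ ≤ s i
  e₀-first = proj₂ (earliest zero)
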